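{- Let $\Delta$ be a connected loop-free bigraph with vertex set $\{1,\dots,n\}$, $n\geq 1$, given by its integers $d_{ij}=d_{ji}$ ($i\neq j$). Consider the following algorithm InflationsToPosSincereRoot$(\Delta)$: 1. set $S:=\{1\}$; 2. while $|S|<n$: choose $(a,b)\in S\times(\{1,\dots,n\}\setminus S)$ such that $d_{ab}\neq 0$ in the current bigraph $\Delta$; if $d_{ab}<0$ (no dotted edges between $a,b$) then set $\Delta:=\mathrm{infl}_b\Delta$; then set $\Delta:=\mathrm{infl}_{b,a}\Delta$; set $S:=S\cup\{b\}$; 3. return $\hat\Delta:=\Delta$. Then this algorithm is correct: every choice required in step 2 exists and every inflation performed is defined, the algorithm terminates, and the returned $\hat\Delta$ is a connected loop-free bigraph with $n$ vertices such that the quadratic form $q_{\hat\Delta}:\mathbb{Z}^n\to\mathbb{Z}$ admits a positive sincere root, and $\Delta$ is positive if and only if $\hat\Delta$ is positive. Moreover, applied to $\Delta$, it performs at most $n-1$ inflations at a vertex and at most $n-1$ inflations at a pair.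
   Context: A loop-free bigraph with vertex set $\{1,\dots,n\}$ is an undirected multigraph without loops whose edges are of two kinds, solid and dotted, such that any two distinct vertices are joined only by edges of one kind. It is encoded by integers $d_{ij}=d_{ji}$ for $i\neq j$: $d_{ij}=-m$ if $i,j$ are joined by $m$ solid edges, $d_{ij}=m$ if joined by $m$ dotted edges ($d_{ij}=0$ if not joined). The bigraph is connected if the underlying graph (all edges regarded as ordinary edges) is connected. Its Gram matrix is the upper triangular integer matrix with $1$'s on the diagonal and entry $d_{ij}$ at $(i,j)$ for $i<j$; the bigraph is positive if its Gram matrix $G$ is positive definite, i.e. $q_\Delta(x):=x^TGx=\sum_i x_i^2+\sum_{i<j}d_{ij}x_ix_j>0$ for all nonzero $x$. Inflation at a vertex $a$: $\mathrm{infl}_a\Delta$ has $d'_{ac}=-d_{ac}$ for all $c\neq a$, all other $d_{ij}$ unchanged. Inflation at a pair $(a,b)$ of distinct vertices, defined only when $d_{ab}>0$: $\mathrm{infl}_{a,b}\Delta$ has $d'_{ab}=-d_{ab}$, $d'_{bc}=d_{bc}-d_{ac}d_{ab}$ for each $c\neq a,b$ (using the values of $\Delta$), and all other $d_{ij}$ unchanged. A vector $v\in\mathbb{Z}^n$ is a root of $q_\Delta$ if $q_\Delta(v)=1$; it is positive if $v\neq0$ and all $v_i\geq 0$, and sincere if all $v_i\neq 0$. -}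

module Defs where

open import Data.Nat as ℕ using (ℕ; zero; suc)
open import Data.Integer as ℤ using (ℤ; +_; -_; _+_; _*_; _-_; _<_; _≤_)
open import Data.Fin using (Fin; zero; suc; toℕ; _≟_)
open import Data.Fin.Subset using (Subset; _∈_; _∉_; ⁅_⁆; _∪_; ∣_∣)
open import Data.Bool using (Bool; true; false; if_then_else_; _∧_; _∨_; _xor_; not)
open import Data.Product using (Σ; _×_; _,_; ∃)
open import Relation.Nullary using (¬_; yes; no)
open import Relation.Nullary.Decidable using (⌊_⌋)
open import Relation.Binary.PropositionalEquality using (_≡_; _≢_)
open import Relation.Binary.Construct.Closure.ReflexiveTransitive using (Star)

-- A (loop-free) bigraph on vertices Fin n (vertex k+1 of the paper is
-- the Fin element with toℕ = k) is encoded by its integer function d,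
-- d i j = d_ij ; the diagonal is unused (fixed to 0 by convention).
Adj : ℕ → Set
Adj n = Fin n → Fin n → ℤ

IsBigraph : ∀ {n} → Adj n → Set
IsBigraph {n} d = (∀ (i j : Fin n) → d i j ≡ d j i) × (∀ (i : Fin n) → d i i ≡ + 0)

data Path {n} (d : Adj n) : Fin n → Fin n → Set where
  here  : ∀ {i} → Path d i i
  there : ∀ {i k j} → d i k ≢ + 0 → Path d k j → Path d i j

Connected : ∀ {n} → Adj n → Set
Connected {n} d = ∀ (i j : Fin n) → Path d i j

∑ : ∀ {n} → (Fin n → ℤ) → ℤ
∑ {zero}  f = + 0
∑ {suc n} f = f zero + ∑ (λ i → f (suc i))

Gram : ∀ {n} → Adj n → Fin n → Fin n → ℤ
Gram d i j with i ≟ j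
... | yes _ = + 1
... | no _ = if ⌊ toℕ i ℕ.<? toℕ j ⌋ then d i j else + 0

q : ∀ {n} → Adj n → (Fin n → ℤ) → ℤ
q d x = ∑ (λ i → ∑ (λ j → x i * Gram d i j * x j))

NonZeroVec : ∀ {n} → (Fin n → ℤ) → Set
NonZeroVec {n} x = ¬ (∀ (i : Fin n) → x i ≡ + 0)

Positive : ∀ {n} → Adj n → Set
Positive {n} d = ∀ (x : Fin n → ℤ) → NonZeroVec x → + 0 < q d x

IsRoot : ∀ {n} → Adj n → (Fin n → ℤ) → Set
IsRoot d v = q d v ≡ + 1

PositiveVec : ∀ {n} → (Fin n → ℤ) → Set
PositiveVec {n} v = NonZeroVec v × (∀ (i : Fin n) → + 0 ≤ v i)

SincereVec : ∀ {n} → (Fin n → ℤ) → Set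
SincereVec {n} v = ∀ (i : Fin n) → v i ≢ + 0

HasPosSincereRoot : ∀ {n} → Adj n → Set
HasPosSincereRoot {n} d = Σ (Fin n → ℤ) λ v → IsRoot d v × PositiveVec v × SincereVec v

_==_ : ∀ {n} → Fin n → Fin n → Bool
i == j = ⌊ i ≟ j ⌋

inflV : ∀ {n} → Fin n → Adj n → Adj n
inflV a d i j = if (i == a) xor (j == a) then - d i j else d i j

inflP : ∀ {n} (a b : Fin n) (d : Adj n) → + 0 < d a b → Adj n
inflP a b d _ i j =
  if ((i == a) ∧ (j == b)) ∨ ((i == b) ∧ (j == a)) then - d a b
  else if (i == b) ∧ not (j == a) ∧ not (j == b) then d b j - d a j * d a b
  else if (j == b) ∧ not (i == a) ∧ not (i == b) then d b i - d a i * d a b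
  else d i j

record State (n : ℕ) : Set where
  constructor st
  field
    graph  : Adj n
    set    : Subset n
    nVert  : ℕ
    nPair  : ℕ
open State public

prep : ∀ {n} → Adj n → Fin n → Fin n → Adj n
prep d a b = if ⌊ d a b ℤ.<? + 0 ⌋ then inflV b d else d

prepCount : ∀ {n} → Adj n → Fin n → Fin n → ℕ
prepCount d a b = if ⌊ d a b ℤ.<? + 0 ⌋ then 1 else 0

Choice : ∀ {n} → State n → Fin n → Fin n → Set
Choice s a b = a ∈ set s × b ∉ set s × graph s a b ≢ + 0

-- one iteration of the while loop (the pair inflation infl_{b,a} can
-- only be performed when it is defined, i.e. d_ba > 0 after prep)
data Step {n} : State n → State n → Set where
  step : ∀ {d S v k} (a b : Fin n) →
         (ch : Choice (st d S v k) a b) →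
         (def : + 0 < prep d a b b a) →
         Step (st d S v k)
              (st (inflP b a (prep d a b) def) (S ∪ ⁅ b ⁆)
                  (v ℕ.+ prepCount d a b) (ℕ.suc k))

init : ∀ {n} → Adj (suc n) → State (suc n)
init d = st d ⁅ zero ⁆ 0 0

Reachable : ∀ {n} → Adj (suc n) → State (suc n) → Set
Reachable d s = Star Step (init d) s

PairInflDefined : ∀ {n} → State n → Fin n → Fin n → Set
PairInflDefined s a b = + 0 < prep (graph s) a b b a

-- Both inflations are ℤ-equivalences of the quadratic form, best seen on the symmetrised
-- Gram matrix G + Gᵀ (2 on the diagonal, d_ij off it): infl_a is the sign change x_a ↦ -x_a,
-- and infl_{x,y} with t = d_xy > 0 is the transvection x_x ↦ x_x - t·x_y. Hence positivity is
-- preserved, as are symmetry, loop-freeness and connectivity. The loop maintains a root of q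
-- that is positive exactly on S: initially the unit vector e_1; infl_b with b ∉ S fixes it, and
-- infl_{b,a} sends it to v + t·v_a·e_b, which is positive at the new vertex b. While |S| < n,
-- connectivity provides an edge leaving S, and |S| = 1 + (number of pair inflations), so the
-- final root is positive and sincere.

module Submission where

open import Defs
open import Data.Bool using (true; false; if_then_else_; _xor_)
import Data.Bool.Properties as BP
open import Data.Empty using (⊥-elim)
open import Data.Fin using (Fin; zero; suc; toℕ; _≟_)
open import Data.Fin.Properties using (toℕ-injective)
open import Data.Fin.Subset using (Subset; inside; outside; _∈_; _∉_; ⁅_⁆; _∪_; ∣_∣)
import Data.Fin.Subset.Properties as SP
open import Data.Integer as ℤ using (ℤ; +_; -_; _+_; _*_; _-_)
import Data.Integer.Properties as ℤP
open import Algebra.Properties.Semiring.Sum ℤP.+-*-semiring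
  using (sum; sum-syntax; sum-cong-≗; ∑-distrib-+; ∑-comm; *-distribˡ-sum; sum-replicate-zero)
open import Data.Integer.Tactic.RingSolver using (solve-∀)
open import Data.Nat as ℕ using (ℕ; zero; suc; _≤_; _<_)
import Data.Nat.Properties as ℕP
open import Data.Product using (_×_; _,_; ∃; ∃₂; proj₁; proj₂)
open import Data.Sum using (inj₁; inj₂)
open import Data.Vec using (_∷_; here; there)
open import Function.Base using (_∘_)
open import Function.Bundles using (_⇔_; mk⇔)
open import Function.Construct.Composition using (_⇔-∘_)
open import Function.Construct.Identity using (⇔-id)
open import Relation.Binary.Construct.Closure.ReflexiveTransitive using (Star; ε; _◅_)
open import Relation.Binary.Definitions using (tri<; tri≈; tri>)
open import Relation.Binary.PropositionalEquality
open import Relation.Nullary using (yes; no)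
open import Relation.Nullary.Decidable using (toSum)

==-refl : ∀ {n} (i : Fin n) → (i == i) ≡ true
==-refl i with i ≟ i
... | yes _   = refl
... | no i≢i = ⊥-elim (i≢i refl)

==-≢ : ∀ {n} {i j : Fin n} → i ≢ j → (i == j) ≡ false
==-≢ {i = i} {j} i≢j with i ≟ j
... | yes i≡j = ⊥-elim (i≢j i≡j)
... | no _    = refl

∑≡sum : ∀ {n} (f : Fin n → ℤ) → ∑ f ≡ sum f
∑≡sum {zero}  f = refl
∑≡sum {suc n} f = cong (_+_ (f zero)) (∑≡sum (f ∘ suc))

δ : ∀ {n} → Fin n → Fin n → ℤ
δ a i = if a == i then + 1 else + 0

δ-refl : ∀ {n} (a : Fin n) → δ a a ≡ + 1
δ-refl a rewrite ==-refl a = refl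

δ-≢ : ∀ {n} {a i : Fin n} → a ≢ i → δ a i ≡ + 0
δ-≢ a≢i rewrite ==-≢ a≢i = refl

δ-suc : ∀ {n} (a i : Fin n) → δ (suc a) (suc i) ≡ δ a i
δ-suc a i with a ≟ i
... | yes refl = refl
... | no _     = refl

sum-δ : ∀ {n} (a : Fin n) (f : Fin n → ℤ) → sum (λ i → δ a i * f i) ≡ f a
sum-δ {suc n} zero f = begin
  + 1 * f zero + sum (λ i → δ zero (suc i) * f (suc i)) ≡⟨ cong₂ _+_ (ℤP.*-identityˡ (f zero))
                                                              (sum-cong-≗ (ℤP.*-zeroˡ ∘ f ∘ suc)) ⟩
  f zero + sum {n} (λ _ → + 0)                          ≡⟨ cong (_+_ (f zero)) (sum-replicate-zero n) ⟩
  f zero + + 0                                          ≡⟨ ℤP.+-identityʳ (f zero) ⟩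
  f zero                                                ∎
  where open ≡-Reasoning
sum-δ {suc n} (suc a) f = begin
  δ (suc a) zero * f zero + sum (λ i → δ (suc a) (suc i) * f (suc i)) ≡⟨ cong₂ _+_ (ℤP.*-zeroˡ (f zero))
                                                                            (sum-cong-≗ λ i → cong (λ c → c * f (suc i)) (δ-suc a i)) ⟩
  + 0 + sum (λ i → δ a i * f (suc i))                                   ≡⟨ ℤP.+-identityˡ _ ⟩
  sum (λ i → δ a i * f (suc i))                                         ≡⟨ sum-δ a (f ∘ suc) ⟩
  f (suc a)                                                             ∎
  where open ≡-Reasoning

∑∑ : ∀ {n} → (Fin n → Fin n → ℤ) → ℤ
∑∑ {n} f = ∑[ i < n ] ∑[ j < n ] f i j

∑∑-cong : ∀ {n} {f g : Fin n → Fin n → ℤ} → (∀ i j → f i j ≡ g i j) → ∑∑ f ≡ ∑∑ g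
∑∑-cong f≡g = sum-cong-≗ λ i → sum-cong-≗ (f≡g i)

∑∑-distrib-+ : ∀ {n} (f g : Fin n → Fin n → ℤ) → ∑∑ (λ i j → f i j + g i j) ≡ ∑∑ f + ∑∑ g
∑∑-distrib-+ f g = trans (sum-cong-≗ λ i → ∑-distrib-+ (f i) (g i)) (∑-distrib-+ (λ i → sum (f i)) (λ i → sum (g i)))

∑∑-δ-row : ∀ {n} (y : Fin n) (f : Fin n → Fin n → ℤ) → ∑∑ (λ i j → δ y i * f i j) ≡ sum (f y)
∑∑-δ-row y f = trans (sum-cong-≗ λ i → sym (*-distribˡ-sum (δ y i) (f i))) (sum-δ y (sum ∘ f))

∑∑-δ-col : ∀ {n} (y : Fin n) (f : Fin n → Fin n → ℤ) → ∑∑ (λ i j → δ y j * f i j) ≡ sum (λ i → f i y)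
∑∑-δ-col y f = sum-cong-≗ λ i → sum-δ y (f i)

∑∑-δ-expand : ∀ {n} (y : Fin n) (f g h k : Fin n → Fin n → ℤ) →
  ∑∑ (λ i j → f i j + δ y i * g i j + δ y j * h i j + δ y i * (δ y j * k i j))
  ≡ ∑∑ f + sum (g y) + sum (λ i → h i y) + k y y
∑∑-δ-expand {n} y f g h k = begin
  ∑∑ (λ i j → f i j + G i j + H i j + K i j)   ≡⟨ ∑∑-distrib-+ (λ i j → f i j + G i j + H i j) K ⟩
  ∑∑ (λ i j → f i j + G i j + H i j) + ∑∑ K    ≡⟨ cong₂ _+_ (∑∑-distrib-+ (λ i j → f i j + G i j) H)
                                                            (trans (∑∑-δ-row y (λ i j → δ y j * k i j)) (sum-δ y (k y))) ⟩
  ∑∑ (λ i j → f i j + G i j) + ∑∑ H + k y y    ≡⟨ cong (λ s → s + ∑∑ H + k y y) (∑∑-distrib-+ f G) ⟩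
  ∑∑ f + ∑∑ G + ∑∑ H + k y y                   ≡⟨ cong (λ s → s + k y y)
                                                      (cong₂ _+_ (cong (_+_ (∑∑ f)) (∑∑-δ-row y g)) (∑∑-δ-col y h)) ⟩
  ∑∑ f + sum (g y) + sum (λ i → h i y) + k y y ∎
  where
  open ≡-Reasoning
  G H K : Fin n → Fin n → ℤ
  G i j = δ y i * g i j
  H i j = δ y j * h i j
  K i j = δ y i * (δ y j * k i j)

Symmetric : ∀ {n} → Adj n → Set
Symmetric {n} d = ∀ (i j : Fin n) → d i j ≡ d j i

Form : ∀ {n} → (Fin n → Fin n → ℤ) → (Fin n → ℤ) → ℤ
Form M x = ∑∑ (λ i j → x i * M i j * x j)

Form-cong : ∀ {n} {M N : Fin n → Fin n → ℤ} (x : Fin n → ℤ) → (∀ i j → M i j ≡ N i j) → Form M x ≡ Form N x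
Form-cong x M≡N = ∑∑-cong λ i j → cong (λ c → x i * c * x j) (M≡N i j)

symGram : ∀ {n} → Adj n → Fin n → Fin n → ℤ
symGram d i j = if i == j then + 2 else d i j

symGram-diag : ∀ {n} (d : Adj n) (i : Fin n) → symGram d i i ≡ + 2
symGram-diag d i rewrite ==-refl i = refl

symGram-≢ : ∀ {n} (d : Adj n) {i j : Fin n} → i ≢ j → symGram d i j ≡ d i j
symGram-≢ d i≢j rewrite ==-≢ i≢j = refl

Gram-diag : ∀ {n} (d : Adj n) (i : Fin n) → Gram d i i ≡ + 1
Gram-diag d i with i ≟ i
... | yes _   = refl
... | no i≢i = ⊥-elim (i≢i refl)

Gram-< : ∀ {n} (d : Adj n) {i j : Fin n} → toℕ i < toℕ j → Gram d i j ≡ d i j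
Gram-< d {i} {j} i<j with i ≟ j
... | yes refl = ⊥-elim (ℕP.<-irrefl refl i<j)
... | no _ with toℕ i ℕ.<? toℕ j
...   | yes _   = refl
...   | no i≮j = ⊥-elim (i≮j i<j)

Gram-> : ∀ {n} (d : Adj n) {i j : Fin n} → toℕ j < toℕ i → Gram d i j ≡ + 0
Gram-> d {i} {j} j<i with i ≟ j
... | yes refl = ⊥-elim (ℕP.<-irrefl refl j<i)
... | no _ with toℕ i ℕ.<? toℕ j
...   | yes i<j = ⊥-elim (ℕP.<-asym i<j j<i)
...   | no _    = refl

Gram+Gramᵀ : ∀ {n} {d : Adj n} → Symmetric d → ∀ i j → Gram d i j + Gram d j i ≡ symGram d i j
Gram+Gramᵀ {d = d} d-sym i j with ℕP.<-cmp (toℕ i) (toℕ j)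
... | tri< i<j _ _ rewrite Gram-< d i<j | Gram-> d i<j | ==-≢ (λ i≡j → ℕP.<-irrefl (cong toℕ i≡j) i<j)
  = ℤP.+-identityʳ (d i j)
... | tri≈ _ i≡j _ rewrite toℕ-injective i≡j | Gram-diag d j | ==-refl j = refl
... | tri> _ _ j<i rewrite Gram-> d j<i | Gram-< d j<i | ==-≢ (λ i≡j → ℕP.<-irrefl (cong toℕ (sym i≡j)) j<i)
  = trans (ℤP.+-identityˡ (d j i)) (d-sym j i)

q≡Form-Gram : ∀ {n} (d : Adj n) (x : Fin n → ℤ) → q d x ≡ Form (Gram d) x
q≡Form-Gram {n} d x = trans (∑≡sum (λ i → ∑ (xGx i))) (sum-cong-≗ λ i → ∑≡sum (xGx i))
  where
  xGx : Fin n → Fin n → ℤ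
  xGx i j = x i * Gram d i j * x j

2q≡Form-symGram : ∀ {n} {d : Adj n} → Symmetric d → ∀ x → + 2 * q d x ≡ Form (symGram d) x
2q≡Form-symGram {d = d} d-sym x = begin
  + 2 * q d x                                                                ≡⟨ double (q d x) ⟩
  q d x + q d x                                                              ≡⟨ cong₂ _+_ (q≡Form-Gram d x) (q≡Form-Gram d x) ⟩
  Form (Gram d) x + Form (Gram d) x                                          ≡⟨ cong (_+_ (Form (Gram d) x)) (∑-comm (λ i j → x i * Gram d i j * x j)) ⟩
  Form (Gram d) x + ∑∑ (λ i j → x j * Gram d j i * x i)                      ≡⟨ ∑∑-distrib-+ (λ i j → x i * Gram d i j * x j) (λ i j → x j * Gram d j i * x i) ⟨
  ∑∑ (λ i j → x i * Gram d i j * x j + x j * Gram d j i * x i)               ≡⟨ ∑∑-cong (λ i j → collect (x i) (Gram d i j) (Gram d j i) (x j)) ⟩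
  ∑∑ (λ i j → x i * (Gram d i j + Gram d j i) * x j)                         ≡⟨ Form-cong x (Gram+Gramᵀ d-sym) ⟩
  Form (symGram d) x                                                         ∎
  where
  open ≡-Reasoning
  double : ∀ a → + 2 * a ≡ a + a
  double = solve-∀
  collect : ∀ u g h w → u * g * w + w * h * u ≡ u * (g + h) * w
  collect = solve-∀

Form-symGram≡⇒q≡ : ∀ {n} {d d' : Adj n} → Symmetric d → Symmetric d' → ∀ x y →
  Form (symGram d') y ≡ Form (symGram d) x → q d' y ≡ q d x
Form-symGram≡⇒q≡ {d = d} {d'} d-sym d'-sym x y eq = ℤP.*-cancelˡ-≡ (+ 2) (q d' y) (q d x) (begin
  + 2 * q d' y        ≡⟨ 2q≡Form-symGram d'-sym y ⟩
  Form (symGram d') y ≡⟨ eq ⟩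
  Form (symGram d) x  ≡⟨ 2q≡Form-symGram d-sym x ⟨
  + 2 * q d x         ∎)
  where open ≡-Reasoning

q-cong : ∀ {n} (d : Adj n) {x y : Fin n → ℤ} → (∀ i → x i ≡ y i) → q d x ≡ q d y
q-cong d {x} {y} x≗y = begin
  q d x           ≡⟨ q≡Form-Gram d x ⟩
  Form (Gram d) x ≡⟨ ∑∑-cong (λ i j → cong₂ (λ u v → u * Gram d i j * v) (x≗y i) (x≗y j)) ⟩
  Form (Gram d) y ≡⟨ q≡Form-Gram d y ⟨
  q d y           ∎
  where open ≡-Reasoning

Form-δ : ∀ {n} (M : Fin n → Fin n → ℤ) (a : Fin n) → Form M (δ a) ≡ M a a
Form-δ M a = begin
  ∑∑ (λ i j → δ a i * M i j * δ a j)     ≡⟨ ∑∑-cong (λ i j → reorder (δ a i) (M i j) (δ a j)) ⟩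
  ∑∑ (λ i j → δ a i * (δ a j * M i j))   ≡⟨ ∑∑-δ-row a (λ i j → δ a j * M i j) ⟩
  sum (λ j → δ a j * M a j)              ≡⟨ sum-δ a (M a) ⟩
  M a a                                  ∎
  where
  open ≡-Reasoning
  reorder : ∀ e m e' → e * m * e' ≡ e * (e' * m)
  reorder = solve-∀

δ-root : ∀ {n} (d : Adj n) (a : Fin n) → IsRoot d (δ a)
δ-root d a = trans (q≡Form-Gram d (δ a)) (trans (Form-δ (Gram d) a) (Gram-diag d a))

Form-update : ∀ {n} (M N : Fin n → Fin n → ℤ) (y : Fin n) (r c : Fin n → ℤ) (k : ℤ) →
  (∀ i j → N i j ≡ M i j + δ y i * r j + δ y j * c i + δ y i * (δ y j * k)) → ∀ Y →
  Form N Y ≡ Form M Y + sum (λ j → Y y * r j * Y j) + sum (λ i → Y i * c i * Y y) + Y y * k * Y y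
Form-update M N y r c k N≡ Y = trans (∑∑-cong expand)
  (∑∑-δ-expand y (λ i j → Y i * M i j * Y j) (λ i j → Y i * r j * Y j) (λ i j → Y i * c i * Y j) (λ i j → Y i * k * Y j))
  where
  distrib : ∀ u m r c k w e e' → u * (m + e * r + e' * c + e * (e' * k)) * w
                                 ≡ u * m * w + e * (u * r * w) + e' * (u * c * w) + e * (e' * (u * k * w))
  distrib = solve-∀
  expand : ∀ i j → Y i * N i j * Y j ≡ Y i * M i j * Y j + δ y i * (Y i * r j * Y j)
                                       + δ y j * (Y i * c i * Y j) + δ y i * (δ y j * (Y i * k * Y j))
  expand i j = trans (cong (λ z → Y i * z * Y j) (N≡ i j)) (distrib (Y i) (M i j) (r j) (c i) k (Y j) (δ y i) (δ y j))

Form-shift : ∀ {n} (M : Fin n → Fin n → ℤ) (x : Fin n) (s : ℤ) (Y : Fin n → ℤ) →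
  Form M (λ k → Y k + δ x k * s)
  ≡ Form M Y + sum (λ j → s * M x j * Y j) + sum (λ i → Y i * M i x * s) + s * M x x * s
Form-shift M x s Y = trans (∑∑-cong expand)
  (∑∑-δ-expand x (λ i j → Y i * M i j * Y j) (λ i j → s * M i j * Y j) (λ i j → Y i * M i j * s) (λ i j → s * M i j * s))
  where
  distrib : ∀ u m w e e' s → (u + e * s) * m * (w + e' * s)
                             ≡ u * m * w + e * (s * m * w) + e' * (u * m * s) + e * (e' * (s * m * s))
  distrib = solve-∀
  expand : ∀ i j → (Y i + δ x i * s) * M i j * (Y j + δ x j * s)
                   ≡ Y i * M i j * Y j + δ x i * (s * M i j * Y j) + δ x j * (Y i * M i j * s) + δ x i * (δ x j * (s * M i j * s))
  expand i j = distrib (Y i) (M i j) (Y j) (δ x i) (δ x j) s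

record QuadEquiv {n} (d d' : Adj n) : Set where
  field
    to from      : (Fin n → ℤ) → (Fin n → ℤ)
    q-to         : ∀ y → q d' y ≡ q d (to y)
    to∘from      : ∀ x i → to (from x) i ≡ x i
    to-nonzero   : ∀ y → NonZeroVec y → NonZeroVec (to y)
    from-nonzero : ∀ x → NonZeroVec x → NonZeroVec (from x)

module _ {n} {d d' : Adj n} (E : QuadEquiv d d') where
  open QuadEquiv E

  q-from : ∀ x → q d' (from x) ≡ q d x
  q-from x = trans (q-to (from x)) (q-cong d (to∘from x))

  QuadEquiv-positive : Positive d ⇔ Positive d'
  QuadEquiv-positive = mk⇔
    (λ d-pos y y≢0 → subst (+ 0 ℤ.<_) (sym (q-to y)) (d-pos (to y) (to-nonzero y y≢0)))
    (λ d'-pos x x≢0 → subst (+ 0 ℤ.<_) (q-from x) (d'-pos (from x) (from-nonzero x x≢0)))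

  QuadEquiv-root : ∀ v → IsRoot d v → IsRoot d' (from v)
  QuadEquiv-root v v-root = trans (q-from v) v-root

_++ₚ_ : ∀ {n} {d : Adj n} {i k j} → Path d i k → Path d k j → Path d i j
here       ++ₚ q = q
there e p ++ₚ q = there e (p ++ₚ q)

edge : ∀ {n} {d : Adj n} {i j} → d i j ≢ + 0 → Path d i j
edge e = there e here

Path-reverse : ∀ {n} {d : Adj n} → Symmetric d → ∀ {i j} → Path d i j → Path d j i
Path-reverse d-sym here                  = here
Path-reverse d-sym (there {i} {k} e p) = Path-reverse d-sym p ++ₚ edge (e ∘ trans (d-sym i k))

Connected-map : ∀ {n} {d d' : Adj n} → (∀ i j → d i j ≢ + 0 → Path d' i j) → Connected d → Connected d'
Connected-map {d = d} {d'} edge⇒path d-conn i j = go (d-conn i j)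
  where
  go : ∀ {i j} → Path d i j → Path d' i j
  go here                  = here
  go (there {i} {k} e p) = edge⇒path i k e ++ₚ go p

Path-exit : ∀ {n} {g : Adj n} {S : Subset n} {i j} → Path g i j → i ∈ S → j ∉ S →
  ∃₂ λ a b → a ∈ S × b ∉ S × g a b ≢ + 0
Path-exit here i∈S i∉S = ⊥-elim (i∉S i∈S)
Path-exit {S = S} (there {k = k} e p) i∈S j∉S with k SP.∈? S
... | yes k∈S = Path-exit p k∈S j∉S
... | no k∉S  = _ , _ , i∈S , k∉S , e

flipAt : ∀ {n} → Fin n → (Fin n → ℤ) → (Fin n → ℤ)
flipAt a y i = if i == a then - y i else y i

flipAt-involutive : ∀ {n} (a : Fin n) (y : Fin n → ℤ) i → flipAt a (flipAt a y) i ≡ y i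
flipAt-involutive a y i with i == a
... | true  = ℤP.neg-involutive (y i)
... | false = refl

flipAt-nonzero : ∀ {n} (a : Fin n) (y : Fin n → ℤ) → NonZeroVec y → NonZeroVec (flipAt a y)
flipAt-nonzero a y y≢0 flip≡0 = y≢0 λ i → y≡0 i (flip≡0 i)
  where
  y≡0 : ∀ i → flipAt a y i ≡ + 0 → y i ≡ + 0
  y≡0 i with i == a
  ... | true  = ℤP.neg-injective
  ... | false = λ e → e

flipAt-fixes : ∀ {n} (a : Fin n) (y : Fin n → ℤ) → y a ≡ + 0 → ∀ i → flipAt a y i ≡ y i
flipAt-fixes a y ya≡0 i with i ≟ a
... | yes refl = trans (cong -_ ya≡0) (sym ya≡0)
... | no _     = refl

inflV-symmetric : ∀ {n} (a : Fin n) {d : Adj n} → Symmetric d → Symmetric (inflV a d)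
inflV-symmetric a d-sym i j rewrite BP.xor-comm (i == a) (j == a) | d-sym i j = refl

inflV-diag : ∀ {n} (a : Fin n) (d : Adj n) i → inflV a d i i ≡ d i i
inflV-diag a d i rewrite BP.xor-same (i == a) = refl

inflV-edge : ∀ {n} (a : Fin n) (d : Adj n) {i j} → d i j ≢ + 0 → inflV a d i j ≢ + 0
inflV-edge a d {i} {j} dij≢0 with (i == a) xor (j == a)
... | true  = dij≢0 ∘ ℤP.neg-injective
... | false = dij≢0

symGram-inflV : ∀ {n} (a : Fin n) (d : Adj n) (y : Fin n → ℤ) i j →
  y i * symGram (inflV a d) i j * y j ≡ flipAt a y i * symGram d i j * flipAt a y j
symGram-inflV a d y i j with i ≟ a | j ≟ a
... | yes refl | yes refl rewrite ==-refl i = both (y i)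
  where both : ∀ u → u * + 2 * u ≡ - u * + 2 * - u
        both = solve-∀
... | yes refl | no j≢i rewrite ==-≢ (≢-sym j≢i) = left (y i) (d i j) (y j)
  where left : ∀ u c w → u * - c * w ≡ - u * c * w
        left = solve-∀
... | no i≢j | yes refl rewrite ==-≢ i≢j = right (y i) (d i j) (y j)
  where right : ∀ u c w → u * - c * w ≡ u * c * - w
        right = solve-∀
... | no _ | no _ = refl

inflV-QuadEquiv : ∀ {n} (a : Fin n) {d : Adj n} → Symmetric d → QuadEquiv d (inflV a d)
inflV-QuadEquiv a {d} d-sym = record
  { to           = flipAt a
  ; from         = flipAt a
  ; q-to         = λ y → Form-symGram≡⇒q≡ d-sym (inflV-symmetric a d-sym) (flipAt a y) y
                           (∑∑-cong (symGram-inflV a d y))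
  ; to∘from      = flipAt-involutive a
  ; to-nonzero   = flipAt-nonzero a
  ; from-nonzero = flipAt-nonzero a
  }

module Transvection {n} {x y : Fin n} (x≢y : x ≢ y) where

  transvection : ℤ → (Fin n → ℤ) → (Fin n → ℤ)
  transvection c Y k = Y k + δ x k * (c * Y y)

  transvection-≢ : ∀ c Y {k} → x ≢ k → transvection c Y k ≡ Y k
  transvection-≢ c Y {k} x≢k rewrite δ-≢ x≢k = trans (cong (_+_ (Y k)) (ℤP.*-zeroˡ (c * Y y))) (ℤP.+-identityʳ (Y k))

  transvection-inverse : ∀ c Y k → transvection (- c) (transvection c Y) k ≡ Y k
  transvection-inverse c Y k rewrite transvection-≢ c Y x≢y = cancel (Y k) (δ x k) c (Y y)
    where cancel : ∀ a e u b → a + e * (u * b) + e * (- u * b) ≡ a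
          cancel = solve-∀

  transvection-nonzero : ∀ c Y → NonZeroVec Y → NonZeroVec (transvection c Y)
  transvection-nonzero c Y Y≢0 T≡0 = Y≢0 λ k → begin
    Y k                             ≡⟨ transvection-inverse c Y k ⟨
    T k + δ x k * (- c * T y)       ≡⟨ cong₂ (λ u v → u + δ x k * (- c * v)) (T≡0 k) (T≡0 y) ⟩
    + 0 + δ x k * (- c * + 0)       ≡⟨ vanish (δ x k) c ⟩
    + 0                             ∎
    where
    open ≡-Reasoning
    T : Fin n → ℤ
    T = transvection c Y
    vanish : ∀ e u → + 0 + e * (- u * + 0) ≡ + 0
    vanish = solve-∀

module PairInflation {n} {x y : Fin n} (x≢y : x ≢ y) {d : Adj n} (d-sym : Symmetric d) (t>0 : + 0 ℤ.< d x y) where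
  open Transvection x≢y

  private
    d' : Adj n
    d' = inflP x y d t>0
    t : ℤ
    t = d x y
    y≢x : y ≢ x
    y≢x = ≢-sym x≢y
    -t≢0 : - t ≢ + 0
    -t≢0 -t≡0 = ℤP.<-irrefl refl (subst (+ 0 ℤ.<_) (ℤP.neg-injective -t≡0) t>0)

  inflP-xy : d' x y ≡ - t
  inflP-xy rewrite ==-refl x | ==-refl y = refl

  inflP-yx : d' y x ≡ - t
  inflP-yx rewrite ==-refl x | ==-refl y | ==-≢ y≢x = refl

  inflP-row : ∀ {j} → j ≢ x → j ≢ y → d' y j ≡ d y j - d x j * t
  inflP-row j≢x j≢y rewrite ==-refl y | ==-≢ y≢x | ==-≢ j≢x | ==-≢ j≢y = refl

  inflP-col : ∀ {i} → i ≢ x → i ≢ y → d' i y ≡ d y i - d x i * t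
  inflP-col i≢x i≢y rewrite ==-refl y | ==-≢ i≢x | ==-≢ i≢y = refl

  inflP-away : ∀ {i j} → i ≢ y → j ≢ y → d' i j ≡ d i j
  inflP-away {i} i≢y j≢y rewrite ==-≢ i≢y | ==-≢ j≢y | BP.∧-zeroʳ (i == x) = refl

  inflP-yy : d' y y ≡ d y y
  inflP-yy rewrite ==-refl y | ==-≢ y≢x = refl

  inflP-symmetric : Symmetric d'
  inflP-symmetric i j with toSum (i ≟ y) | toSum (j ≟ y)
  ... | inj₁ refl | inj₁ refl = refl
  ... | inj₁ refl | inj₂ j≢y with toSum (j ≟ x)
  ...   | inj₁ refl = trans inflP-yx (sym inflP-xy)
  ...   | inj₂ j≢x  = trans (inflP-row j≢x j≢y) (sym (inflP-col j≢x j≢y))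
  inflP-symmetric i j | inj₂ i≢y | inj₁ refl with toSum (i ≟ x)
  ...   | inj₁ refl = trans inflP-xy (sym inflP-yx)
  ...   | inj₂ i≢x  = trans (inflP-col i≢x i≢y) (sym (inflP-row i≢x i≢y))
  inflP-symmetric i j | inj₂ i≢y | inj₂ j≢y = trans (inflP-away i≢y j≢y) (trans (d-sym i j) (sym (inflP-away j≢y i≢y)))

  inflP-diag : ∀ i → d' i i ≡ d i i
  inflP-diag i with toSum (i ≟ y)
  ... | inj₁ refl = inflP-yy
  ... | inj₂ i≢y  = inflP-away i≢y i≢y

  -- an edge y–j lost by the inflation is replaced by the path y–x–j
  inflP-path-from-y : ∀ j → d y j ≢ + 0 → Path d' y j
  inflP-path-from-y j dyj≢0 with toSum (j ≟ y) | toSum (j ≟ x)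
  ... | inj₁ refl | _         = here
  ... | inj₂ _    | inj₁ refl = edge (-t≢0 ∘ trans (sym inflP-yx))
  ... | inj₂ j≢y  | inj₂ j≢x with d' y j ℤ.≟ + 0
  ...   | no d'yj≢0  = edge d'yj≢0
  ...   | yes d'yj≡0 = edge (-t≢0 ∘ trans (sym inflP-yx)) ++ₚ edge (dxj≢0 ∘ trans (sym (inflP-away x≢y j≢y)))
    where
    dxj≢0 : d x j ≢ + 0
    dxj≢0 dxj≡0 = dyj≢0 (begin
      d y j               ≡⟨ minus-zero (d y j) t ⟨
      d y j - + 0 * t     ≡⟨ cong (λ c → d y j - c * t) dxj≡0 ⟨
      d y j - d x j * t   ≡⟨ inflP-row j≢x j≢y ⟨
      d' y j              ≡⟨ d'yj≡0 ⟩
      + 0                 ∎)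
      where
      open ≡-Reasoning
      minus-zero : ∀ a u → a - + 0 * u ≡ a
      minus-zero = solve-∀

  inflP-path : ∀ i j → d i j ≢ + 0 → Path d' i j
  inflP-path i j dij≢0 with toSum (i ≟ y) | toSum (j ≟ y)
  ... | inj₁ refl | _         = inflP-path-from-y j dij≢0
  ... | inj₂ _    | inj₁ refl = Path-reverse inflP-symmetric (inflP-path-from-y i (dij≢0 ∘ trans (d-sym i y)))
  ... | inj₂ i≢y  | inj₂ j≢y  = edge (dij≢0 ∘ trans (sym (inflP-away i≢y j≢y)))

  private
    M : Fin n → Fin n → ℤ
    M = symGram d

  symGram-inflP-away : ∀ {i j} → i ≢ y → j ≢ y → symGram d' i j ≡ M i j
  symGram-inflP-away {i} {j} i≢y j≢y with toSum (i ≟ j)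
  ... | inj₁ refl = trans (symGram-diag d' i) (sym (symGram-diag d i))
  ... | inj₂ i≢j  = trans (symGram-≢ d' i≢j) (trans (inflP-away i≢y j≢y) (sym (symGram-≢ d i≢j)))

  symGram-inflP : ∀ i j → symGram d' i j
    ≡ M i j + δ y i * (- t * M x j) + δ y j * (- t * M i x) + δ y i * (δ y j * (+ 2 * t * t))
  symGram-inflP i j with toSum (i ≟ y) | toSum (j ≟ y)
  ... | inj₁ refl | inj₁ refl
    rewrite symGram-diag d' i | symGram-diag d i | δ-refl i | symGram-≢ d x≢y | symGram-≢ d y≢x | d-sym i x
    = yy (d x i)
    where yy : ∀ u → + 2 ≡ + 2 + + 1 * (- u * u) + + 1 * (- u * u) + + 1 * (+ 1 * (+ 2 * u * u))
          yy = solve-∀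
  ... | inj₁ refl | inj₂ j≢y with toSum (j ≟ x)
  ...   | inj₁ refl
    rewrite symGram-≢ d' y≢x | inflP-yx | symGram-≢ d y≢x | d-sym i j | symGram-diag d j | δ-refl i | δ-≢ y≢x
    = yx (d j i)
    where yx : ∀ u → - u ≡ u + + 1 * (- u * + 2) + + 0 * (- u * u) + + 1 * (+ 0 * (+ 2 * u * u))
          yx = solve-∀
  ...   | inj₂ j≢x
    rewrite symGram-≢ d' (≢-sym j≢y) | inflP-row j≢x j≢y | symGram-≢ d (≢-sym j≢y) | symGram-≢ d (≢-sym j≢x)
          | δ-refl i | δ-≢ (≢-sym j≢y)
    = row (d i j) (d x j) (d x i) (M i x)
    where row : ∀ a b u m → a - b * u ≡ a + + 1 * (- u * b) + + 0 * (- u * m) + + 1 * (+ 0 * (+ 2 * u * u))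
          row = solve-∀
  symGram-inflP i j | inj₂ i≢y | inj₁ refl with toSum (i ≟ x)
  ...   | inj₁ refl
    rewrite symGram-≢ d' x≢y | inflP-xy | symGram-≢ d x≢y | symGram-diag d i | δ-refl j | δ-≢ y≢x
    = xy (d i j)
    where xy : ∀ u → - u ≡ u + + 0 * (- u * u) + + 1 * (- u * + 2) + + 0 * (+ 1 * (+ 2 * u * u))
          xy = solve-∀
  ...   | inj₂ i≢x
    rewrite symGram-≢ d' i≢y | inflP-col i≢x i≢y | symGram-≢ d i≢y | symGram-≢ d i≢x | d-sym i j | d-sym i x
          | δ-refl j | δ-≢ (≢-sym i≢y)
    = col (d j i) (d x i) (d x j) (M x j)
    where col : ∀ a b u m → a - b * u ≡ a + + 0 * (- u * m) + + 1 * (- u * b) + + 0 * (+ 1 * (+ 2 * u * u))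
          col = solve-∀
  symGram-inflP i j | inj₂ i≢y | inj₂ j≢y
    rewrite δ-≢ (≢-sym i≢y) | δ-≢ (≢-sym j≢y)
    = trans (symGram-inflP-away i≢y j≢y) (unchanged (M i j) (M x j) (M i x) t)
    where unchanged : ∀ a b c u → a ≡ a + + 0 * (- u * b) + + 0 * (- u * c) + + 0 * (+ 0 * (+ 2 * u * u))
          unchanged = solve-∀

  Form-inflP : ∀ Y → Form (symGram d') Y ≡ Form M (transvection (- t) Y)
  Form-inflP Y = begin
    Form (symGram d') Y
      ≡⟨ Form-update M (symGram d') y (λ j → - t * M x j) (λ i → - t * M i x) (+ 2 * t * t) symGram-inflP Y ⟩
    Form M Y + sum (λ j → Y y * (- t * M x j) * Y j) + sum (λ i → Y i * (- t * M i x) * Y y) + Y y * (+ 2 * t * t) * Y y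
      ≡⟨ cong₂ _+_ (cong₂ _+_ (cong (_+_ (Form M Y)) (sum-cong-≗ λ j → from-row (Y y) t (M x j) (Y j)))
                              (sum-cong-≗ λ i → from-col (Y i) t (M i x) (Y y)))
                   (trans (from-corner (Y y) t) (cong (λ m → s * m * s) (sym (symGram-diag d x)))) ⟩
    Form M Y + sum (λ j → s * M x j * Y j) + sum (λ i → Y i * M i x * s) + s * M x x * s
      ≡⟨ Form-shift M x s Y ⟨
    Form M (transvection (- t) Y)
      ∎
    where
    open ≡-Reasoning
    s : ℤ
    s = - t * Y y
    from-row : ∀ a u m b → a * (- u * m) * b ≡ (- u * a) * m * b
    from-row = solve-∀
    from-col : ∀ a u m b → a * (- u * m) * b ≡ a * m * (- u * b)
    from-col = solve-∀
    from-corner : ∀ a u → a * (+ 2 * u * u) * a ≡ (- u * a) * + 2 * (- u * a)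
    from-corner = solve-∀

  inflP-QuadEquiv : QuadEquiv d d'
  inflP-QuadEquiv = record
    { to           = transvection (- t)
    ; from         = transvection t
    ; q-to         = λ Y → Form-symGram≡⇒q≡ d-sym inflP-symmetric (transvection (- t) Y) Y (Form-inflP Y)
    ; to∘from      = transvection-inverse t
    ; to-nonzero   = transvection-nonzero (- t)
    ; from-nonzero = transvection-nonzero t
    }

∈∉⇒≢ : ∀ {n} {S : Subset n} {a b : Fin n} → a ∈ S → b ∉ S → a ≢ b
∈∉⇒≢ {S = S} a∈S b∉S a≡b = b∉S (subst (_∈ S) a≡b a∈S)

∣p∣<n⇒∃∉ : ∀ {n} {p : Subset n} → ∣ p ∣ < n → ∃ (_∉ p)
∣p∣<n⇒∃∉ {p = outside ∷ p} _ = zero , λ ()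
∣p∣<n⇒∃∉ {p = inside ∷ p} (ℕ.s≤s |p|<n) with ∣p∣<n⇒∃∉ |p|<n
... | b , b∉p = suc b , b∉p ∘ SP.drop-there

∣p∪⁅x⁆∣ : ∀ {n} {p : Subset n} {x : Fin n} → x ∉ p → ∣ p ∪ ⁅ x ⁆ ∣ ≡ suc ∣ p ∣
∣p∪⁅x⁆∣ {p = inside ∷ p}  {zero}  x∉p = ⊥-elim (x∉p here)
∣p∪⁅x⁆∣ {p = outside ∷ p} {zero}  _   = cong (suc ∘ ∣_∣) (SP.∪-identityʳ p)
∣p∪⁅x⁆∣ {p = inside ∷ p}  {suc x} x∉p = cong suc (∣p∪⁅x⁆∣ (x∉p ∘ there))
∣p∪⁅x⁆∣ {p = outside ∷ p} {suc x} x∉p = ∣p∪⁅x⁆∣ (x∉p ∘ there)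

*-positive : ∀ {a b : ℤ} → + 0 ℤ.< a → + 0 ℤ.< b → + 0 ℤ.< a * b
*-positive {a} {b} a>0 b>0 = subst (ℤ._< a * b) (ℤP.*-zeroʳ a) (ℤP.*-monoˡ-<-pos a {{ℤ.positive a>0}} b>0)

PositiveExactlyOn : ∀ {n} → Subset n → (Fin n → ℤ) → Set
PositiveExactlyOn {n} S v = (∀ (i : Fin n) → i ∈ S → + 0 ℤ.< v i) × (∀ (i : Fin n) → i ∉ S → v i ≡ + 0)

PositiveExactlyOn-cong : ∀ {n} {S : Subset n} {v w} → (∀ i → w i ≡ v i) → PositiveExactlyOn S v → PositiveExactlyOn S w
PositiveExactlyOn-cong w≗v (v>0 , v≡0) = (λ i i∈S → subst (+ 0 ℤ.<_) (sym (w≗v i)) (v>0 i i∈S))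
                                       , (λ i i∉S → trans (w≗v i) (v≡0 i i∉S))

transvection-PositiveExactlyOn : ∀ {n} {x y : Fin n} (x≢y : x ≢ y) {S : Subset n} {c : ℤ} {Y : Fin n → ℤ} →
  x ∉ S → y ∈ S → + 0 ℤ.< c → PositiveExactlyOn S Y → PositiveExactlyOn (S ∪ ⁅ x ⁆) (Transvection.transvection x≢y c Y)
transvection-PositiveExactlyOn {x = x} {y} x≢y {S} {c} {Y} x∉S y∈S c>0 (Y>0 , Y≡0) = positive , vanishing
  where
  open Transvection x≢y
  at-x : transvection c Y x ≡ c * Y y
  at-x rewrite δ-refl x | Y≡0 x x∉S = trans (ℤP.+-identityˡ _) (ℤP.*-identityˡ (c * Y y))
  positive : ∀ i → i ∈ S ∪ ⁅ x ⁆ → + 0 ℤ.< transvection c Y i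
  positive i i∈S∪x with SP.x∈p∪q⁻ S ⁅ x ⁆ i∈S∪x
  ... | inj₁ i∈S = subst (+ 0 ℤ.<_) (sym (transvection-≢ c Y (≢-sym (∈∉⇒≢ i∈S x∉S)))) (Y>0 i i∈S)
  ... | inj₂ i∈x rewrite SP.x∈⁅y⁆⇒x≡y x i∈x = subst (+ 0 ℤ.<_) (sym at-x) (*-positive c>0 (Y>0 y y∈S))
  vanishing : ∀ i → i ∉ S ∪ ⁅ x ⁆ → transvection c Y i ≡ + 0
  vanishing i i∉S∪x = trans (transvection-≢ c Y (∈∉⇒≢ (SP.x∈p∪q⁺ (inj₂ (SP.x∈⁅x⁆ x))) i∉S∪x))
                            (Y≡0 i (i∉S∪x ∘ SP.x∈p∪q⁺ ∘ inj₁))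

record Invariant {n} (d : Adj n) (S : Subset n) (g : Adj n) : Set where
  field
    bigraph      : IsBigraph g
    connected    : Connected g
    positive⇔    : Positive d ⇔ Positive g
    root         : Fin n → ℤ
    isRoot       : IsRoot g root
    root-support : PositiveExactlyOn S root
open Invariant

Invariant-transfer : ∀ {n} {d g g' : Adj n} {S S' : Subset n} → Invariant d S g → (E : QuadEquiv g g') →
  IsBigraph g' → (∀ i j → g i j ≢ + 0 → Path g' i j) →
  (∀ v → PositiveExactlyOn S v → PositiveExactlyOn S' (QuadEquiv.from E v)) → Invariant d S' g'
Invariant-transfer I E g'-bigraph edge⇒path from-support = record
  { bigraph      = g'-bigraph
  ; connected    = Connected-map edge⇒path (connected I)
  ; positive⇔    = QuadEquiv-positive E ⇔-∘ positive⇔ I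
  ; root         = QuadEquiv.from E (root I)
  ; isRoot       = QuadEquiv-root E (root I) (isRoot I)
  ; root-support = from-support (root I) (root-support I)
  }

inflV-Invariant : ∀ {n} {d g : Adj n} {S : Subset n} {b : Fin n} → b ∉ S → Invariant d S g → Invariant d S (inflV b g)
inflV-Invariant {g = g} {b = b} b∉S I = Invariant-transfer I (inflV-QuadEquiv b g-sym)
  (inflV-symmetric b g-sym , λ i → trans (inflV-diag b g i) (g-loopFree i))
  (λ i j → edge ∘ inflV-edge b g)
  (λ v v-support → PositiveExactlyOn-cong (flipAt-fixes b v (proj₂ v-support b b∉S)) v-support)
  where
  g-sym : Symmetric g
  g-sym = proj₁ (bigraph I)
  g-loopFree : ∀ i → g i i ≡ + 0
  g-loopFree = proj₂ (bigraph I)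

inflP-Invariant : ∀ {n} {d g : Adj n} {S : Subset n} {a b : Fin n} → a ∈ S → b ∉ S → (t>0 : + 0 ℤ.< g b a) →
  Invariant d S g → Invariant d (S ∪ ⁅ b ⁆) (inflP b a g t>0)
inflP-Invariant {a = a} {b} a∈S b∉S t>0 I = Invariant-transfer I inflP-QuadEquiv
  (inflP-symmetric , λ i → trans (inflP-diag i) (proj₂ (bigraph I) i))
  inflP-path
  (λ v → transvection-PositiveExactlyOn b≢a b∉S a∈S t>0)
  where
  b≢a : b ≢ a
  b≢a = ≢-sym (∈∉⇒≢ a∈S b∉S)
  open PairInflation b≢a (proj₁ (bigraph I)) t>0

prep-Invariant : ∀ {n} {d g : Adj n} {S : Subset n} (a : Fin n) {b : Fin n} → b ∉ S →
  Invariant d S g → Invariant d S (prep g a b)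
prep-Invariant {g = g} a {b} b∉S I with g a b ℤ.<? + 0
... | yes _ = inflV-Invariant b∉S I
... | no _  = I

prepCount≤1 : ∀ {n} (g : Adj n) (a b : Fin n) → prepCount g a b ≤ 1
prepCount≤1 g a b with g a b ℤ.<? + 0
... | yes _ = ℕP.≤-refl
... | no _  = ℕ.z≤n

prep-positive : ∀ {n} {g : Adj n} → Symmetric g → ∀ {a b} → a ≢ b → g a b ≢ + 0 → + 0 ℤ.< prep g a b b a
prep-positive {g = g} g-sym {a} {b} a≢b gab≢0 with g a b ℤ.<? + 0
... | yes gab<0 rewrite ==-refl b | ==-≢ a≢b = subst (λ c → + 0 ℤ.< - c) (g-sym a b) (ℤP.neg-mono-< gab<0)
... | no gab≮0 = subst (+ 0 ℤ.<_) (g-sym a b) (ℤP.≤∧≢⇒< (ℤP.≮⇒≥ gab≮0) (gab≢0 ∘ sym))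

record LoopInvariant {m} (d : Adj (suc m)) (s : State (suc m)) : Set where
  field
    invariant    : Invariant d (set s) (graph s)
    zero∈set     : zero ∈ set s
    ∣set∣≡1+nPair : ∣ set s ∣ ≡ suc (nPair s)
    nVert≤nPair  : nVert s ≤ nPair s
open LoopInvariant

LoopInvariant-init : ∀ {m} (d : Adj (suc m)) → IsBigraph d → Connected d → LoopInvariant d (init d)
LoopInvariant-init {m} d d-bigraph d-conn = record
  { invariant    = record
    { bigraph      = d-bigraph
    ; connected    = d-conn
    ; positive⇔    = ⇔-id _
    ; root         = δ zero
    ; isRoot       = δ-root d zero
    ; root-support = δ-zero-support
    }
  ; zero∈set     = SP.x∈⁅x⁆ zero
  ; ∣set∣≡1+nPair = SP.∣⁅x⁆∣≡1 {suc m} zero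
  ; nVert≤nPair  = ℕ.z≤n
  }
  where
  δ-zero-support : PositiveExactlyOn ⁅ zero ⁆ (δ zero)
  δ-zero-support = (λ i i∈⁅0⁆ → subst (λ k → + 0 ℤ.< δ zero k) (sym (SP.x∈⁅y⁆⇒x≡y zero i∈⁅0⁆)) (ℤ.+<+ (ℕ.s≤s ℕ.z≤n)))
                 , (λ i i∉⁅0⁆ → δ-≢ (SP.x∉⁅y⁆⇒x≢y i∉⁅0⁆ ∘ sym))

LoopInvariant-step : ∀ {m} {d : Adj (suc m)} {s s'} → LoopInvariant d s → Step s s' → LoopInvariant d s'
LoopInvariant-step L (step {g} {S} {v} {k} a b (a∈S , b∉S , _) t>0) = record
  { invariant    = inflP-Invariant a∈S b∉S t>0 (prep-Invariant a b∉S (invariant L))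
  ; zero∈set     = SP.p⊆p∪q ⁅ b ⁆ (zero∈set L)
  ; ∣set∣≡1+nPair = trans (∣p∪⁅x⁆∣ b∉S) (cong suc (∣set∣≡1+nPair L))
  ; nVert≤nPair  = subst (v ℕ.+ prepCount g a b ≤_) (ℕP.+-comm k 1) (ℕP.+-mono-≤ (nVert≤nPair L) (prepCount≤1 g a b))
  }

LoopInvariant-reachable : ∀ {m} {d : Adj (suc m)} → IsBigraph d → Connected d → ∀ {s} → Reachable d s → LoopInvariant d s
LoopInvariant-reachable {d = d} d-bigraph d-conn = go (LoopInvariant-init d d-bigraph d-conn)
  where
  go : ∀ {s s'} → LoopInvariant d s → Star Step s s' → LoopInvariant d s'
  go L ε        = L
  go L (x ◅ xs) = go (LoopInvariant-step L x) xs

positive⇒PositiveVec×SincereVec : ∀ {m} {v : Fin (suc m) → ℤ} → (∀ i → + 0 ℤ.< v i) → PositiveVec v × SincereVec v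
positive⇒PositiveVec×SincereVec {v = v} v>0 = ((λ v≡0 → v≢0 zero (v≡0 zero)) , (λ i → ℤP.<⇒≤ (v>0 i))) , v≢0
  where
  v≢0 : SincereVec v
  v≢0 i = ℤP.<⇒≢ (v>0 i) ∘ sym

module _ {m} {d : Adj (suc m)} {s : State (suc m)} (L : LoopInvariant d s) where
  private
    I : Invariant d (set s) (graph s)
    I = invariant L

  LoopInvariant-choice : ∣ set s ∣ < suc m →
    (∃₂ λ a b → Choice s a b) × ((a b : Fin (suc m)) → Choice s a b → PairInflDefined s a b)
  LoopInvariant-choice ∣S∣<n =
    Path-exit (connected I zero (proj₁ outside-vertex)) (zero∈set L) (proj₂ outside-vertex) ,
    λ a b (a∈S , b∉S , gab≢0) → prep-positive (proj₁ (bigraph I)) (∈∉⇒≢ a∈S b∉S) gab≢0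
    where
    outside-vertex : ∃ (_∉ set s)
    outside-vertex = ∣p∣<n⇒∃∉ ∣S∣<n

  LoopInvariant-nPair≤ : nPair s ≤ m
  LoopInvariant-nPair≤ = ℕP.≤-pred (subst (_≤ suc m) (∣set∣≡1+nPair L) (SP.∣p∣≤n (set s)))

  LoopInvariant-final : ∣ set s ∣ ≡ suc m →
    IsBigraph (graph s) × Connected (graph s) × HasPosSincereRoot (graph s)
    × (Positive d ⇔ Positive (graph s)) × nVert s ≤ m × nPair s ≤ m
  LoopInvariant-final ∣S∣≡n =
    bigraph I , connected I , (root I , isRoot I , positive⇒PositiveVec×SincereVec root>0) , positive⇔ I ,
    ℕP.≤-trans (nVert≤nPair L) LoopInvariant-nPair≤ , LoopInvariant-nPair≤
    where
    root>0 : ∀ i → + 0 ℤ.< root I i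
    root>0 i = proj₁ (root-support I) i (subst (i ∈_) (sym (SP.∣p∣≡n⇒p≡⊤ ∣S∣≡n)) SP.∈⊤)

theorem4p4 : (m : ℕ) (d : Adj (suc m)) → IsBigraph d → Connected d →
  ((s : State (suc m)) → Reachable d s → ∣ set s ∣ < suc m →
      (∃₂ λ a b → Choice s a b)
      × ((a b : Fin (suc m)) → Choice s a b → PairInflDefined s a b))
  × ((s : State (suc m)) → Reachable d s →
      (∣ set s ∣ ≡ suc (nPair s)) × nPair s ≤ m)
  × ((s : State (suc m)) → Reachable d s → ∣ set s ∣ ≡ suc m →
      IsBigraph (graph s) × Connected (graph s) × HasPosSincereRoot (graph s)
      × (Positive d ⇔ Positive (graph s))
      × nVert s ≤ m × nPair s ≤ m)
theorem4p4 m d d-bigraph d-conn =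
  (λ s r → LoopInvariant-choice (L r)) ,
  (λ s r → ∣set∣≡1+nPair (L r) , LoopInvariant-nPair≤ (L r)) ,
  (λ s r → LoopInvariant-final (L r))
  where
  L : ∀ {s} → Reachable d s → LoopInvariant d s
  L = LoopInvariant-reachable d-bigraph d-conn
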